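{- Let $\alpha>0$ and let $G$ be a graph. Suppose that $A,B$ are disjoint subsets of $V(G)$ such that $|A|\ge 100$, $|B|\le (\alpha/100)|A|$, and every vertex of $B$ has at least $\alpha|A|$ neighbours in $A$. Then there is a partition $A=T\cup T'$ with $|T|,|T'|\ge |A|/3$ such that every vertex of $B$ has at least $(\alpha/2)|T|$ neighbours in $T$.
   Context: All graphs are finite and simple.
   Formalization: The parameter α ranges over the positive rationals. -}

module Defs where

open import Data.Nat using (ℕ)
open import Data.Bool using (Bool; true; false)
open import Data.Fin using (Fin)
open import Data.Fin.Subset using (Subset; _∩_; ∣_∣)
open import Data.Vec using (tabulate)
open import Relation.Binary.PropositionalEquality using (_≡_)

record Graph (n : ℕ) : Set where
  field
    adj   : Fin n → Fin n → Bool
    sym   : ∀ u v → adj u v ≡ adj v u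
    irref : ∀ v → adj v v ≡ false

open Graph public

nbhd : ∀ {n} → Graph n → Fin n → Subset n
nbhd G v = tabulate (adj G v)

degIn : ∀ {n} → Graph n → Fin n → Subset n → ℕ
degIn G v S = ∣ nbhd G v ∩ S ∣

-- A uniformly random 2-colouring τ splits every set X with E[disc²] = |X|, where
-- disc = | |X ∩ τ| - |X ∖ τ| |.  This is derandomised by conditional expectations: for a
-- weighted family of sets, the potential Σ w·disc² minus the weight Σ w·|X| on the
-- remaining vertices is the average of its two values after colouring one more vertex,
-- so colouring greedily ends with potential ≤ weight.  Let s = ⌈α|A|⌉ and, for b ∈ B,
-- let S_b consist of s neighbours of b in A.  With weight s² on A and 100|A| on each S_b
-- the total weight is at most 2s²|A| (as 100|B| ≤ s), which forces disc(A) ≤ |A|/3 and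
-- disc(S_b) ≤ s/3.  Hence T = A ∩ τ and T′ = A ∖ τ have between |A|/3 and 2|A|/3
-- vertices, and each b ∈ B has at least s/3 ≥ α|A|/3 ≥ (α/2)|T| neighbours in T.
module Submission where

open import Data.Bool using (true; false)
open import Data.Fin using (Fin; zero; suc)
open import Data.Fin.Subset using (Subset; _∩_; _∪_; ∁; ∣_∣; outside; inside; ⊥; _⊆_; _∈_)
open import Data.Fin.Subset.Properties using (⊥⊆; out⊆; s⊆s; ∣⊥∣≡0; x∈p∩q⁺; x∈p∩q⁻; ∩-assoc; p⊆q⇒∣p∣≤∣q∣)
open import Data.List using (List; []; _∷_; map; length)
open import Data.List.Membership.Propositional using () renaming (_∈_ to _∈ₗ_)
open import Data.List.Membership.Propositional.Properties using (∈-map⁺)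
open import Data.List.Properties using (length-map)
open import Data.List.Relation.Unary.Any using (here; there)
open import Data.Nat using (ℕ; zero; suc; _+_; _*_; _≤_; z≤n; s≤s; s≤s⁻¹; ∣_-_∣; NonZero; pred; >-nonZero)
open import Data.Nat.DivMod using (_/_; _%_; m≡m%n+[m/n]*n; m%n<n; m<n*o⇒m/o<n; m≥n⇒m/n>0)
open import Data.Nat.ListAction using (sum)
open import Data.Nat.Properties
open import Data.Nat.Tactic.RingSolver using (solve-∀)
open import Data.Product using (Σ; _×_; _,_; proj₁; proj₂; ∃-syntax)
open import Data.Sum using (inj₁; inj₂)
open import Data.Vec using ([]; _∷_; tail; here; there)
open import Relation.Binary.PropositionalEquality
  using (_≡_; refl; sym; trans; cong; cong₂; subst; subst₂; module ≡-Reasoning)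

open import Defs using (Graph; nbhd; degIn)

m≤n⇒m+n≤2o⇒m≤o : ∀ {m n o} → m ≤ n → m + n ≤ 2 * o → m ≤ o
m≤n⇒m+n≤2o⇒m≤o {m} {n} {o} m≤n m+n≤2o = *-cancelˡ-≤ 2 (begin
  2 * m   ≡⟨ cong (m +_) (+-identityʳ m) ⟩
  m + m   ≤⟨ +-monoʳ-≤ m m≤n ⟩
  m + n   ≤⟨ m+n≤2o ⟩
  2 * o   ∎)
  where open ≤-Reasoning

m*m≤n*n⇒m≤n : ∀ {m n} → m * m ≤ n * n → m ≤ n
m*m≤n*n⇒m≤n m*m≤n*n = ≮⇒≥ (λ n<m → <⇒≱ (*-mono-< n<m n<m) m*m≤n*n)

w*d²≤W⇒9W≤w*k²⇒3d≤k : ∀ w d k W .{{_ : NonZero w}} → w * (d * d) ≤ W → 9 * W ≤ w * (k * k) → 3 * d ≤ k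
w*d²≤W⇒9W≤w*k²⇒3d≤k w d k W w*d²≤W 9W≤w*k² = m*m≤n*n⇒m≤n (*-cancelˡ-≤ w (begin
  w * (3 * d * (3 * d)) ≡⟨ nine w d ⟩
  9 * (w * (d * d))     ≤⟨ *-monoʳ-≤ 9 w*d²≤W ⟩
  9 * W                 ≤⟨ 9W≤w*k² ⟩
  w * (k * k)           ∎))
  where
  open ≤-Reasoning
  nine : ∀ w d → w * (3 * d * (3 * d)) ≡ 9 * (w * (d * d))
  nine = solve-∀

3∣m-n∣≤m+n⇒m+n≤3m : ∀ m n → 3 * ∣ m - n ∣ ≤ m + n → m + n ≤ 3 * m
3∣m-n∣≤m+n⇒m+n≤3m m n 3d≤m+n = *-cancelˡ-≤ 2 (+-cancelʳ-≤ (m + n) (2 * (m + n)) (2 * (3 * m)) (begin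
  2 * (m + n) + (m + n)         ≡⟨ triple m n ⟩
  3 * m + 3 * n                 ≤⟨ +-monoʳ-≤ (3 * m) (*-monoʳ-≤ 3 n≤m+d) ⟩
  3 * m + 3 * (m + ∣ m - n ∣)   ≡⟨ six m ∣ m - n ∣ ⟩
  2 * (3 * m) + 3 * ∣ m - n ∣   ≤⟨ +-monoʳ-≤ (2 * (3 * m)) 3d≤m+n ⟩
  2 * (3 * m) + (m + n)         ∎))
  where
  open ≤-Reasoning
  n≤m+d : n ≤ m + ∣ m - n ∣
  n≤m+d = subst (λ d → n ≤ m + d) (∣-∣-comm n m) (m≤n+∣m-n∣ n m)
  triple : ∀ m n → 2 * (m + n) + (m + n) ≡ 3 * m + 3 * n
  triple = solve-∀
  six : ∀ m d → 3 * m + 3 * (m + d) ≡ 2 * (3 * m) + 3 * d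
  six = solve-∀

m+n≤3n⇒3m≤2[m+n] : ∀ m n → m + n ≤ 3 * n → 3 * m ≤ 2 * (m + n)
m+n≤3n⇒3m≤2[m+n] m n m+n≤3n = +-cancelʳ-≤ (m + n) (3 * m) (2 * (m + n)) (begin
  3 * m + (m + n)       ≤⟨ +-monoʳ-≤ (3 * m) m+n≤3n ⟩
  3 * m + 3 * n         ≡⟨ regroup m n ⟩
  2 * (m + n) + (m + n) ∎)
  where
  open ≤-Reasoning
  regroup : ∀ m n → 3 * m + 3 * n ≡ 2 * (m + n) + (m + n)
  regroup = solve-∀

∣1+m-n∣²+∣m-1+n∣²≡2∣m-n∣²+2 : ∀ m n →
  ∣ suc m - n ∣ * ∣ suc m - n ∣ + ∣ m - suc n ∣ * ∣ m - suc n ∣ ≡ 2 * (∣ m - n ∣ * ∣ m - n ∣) + 2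
∣1+m-n∣²+∣m-1+n∣²≡2∣m-n∣²+2 zero    zero    = refl
∣1+m-n∣²+∣m-1+n∣²≡2∣m-n∣²+2 zero    (suc n) = edge n
  where
  edge : ∀ k → k * k + (2 + k) * (2 + k) ≡ 2 * ((1 + k) * (1 + k)) + 2
  edge = solve-∀
∣1+m-n∣²+∣m-1+n∣²≡2∣m-n∣²+2 (suc m) zero    rewrite ∣-∣-identityʳ m = edge m
  where
  edge : ∀ k → (2 + k) * (2 + k) + k * k ≡ 2 * ((1 + k) * (1 + k)) + 2
  edge = solve-∀
∣1+m-n∣²+∣m-1+n∣²≡2∣m-n∣²+2 (suc m) (suc n) = ∣1+m-n∣²+∣m-1+n∣²≡2∣m-n∣²+2 m n

⌈_/_⌉ : (m n : ℕ) .{{_ : NonZero n}} → ℕ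
⌈ m / n ⌉ = (m + pred n) / n

m≤n*⌈m/n⌉ : ∀ m n .{{_ : NonZero n}} → m ≤ n * ⌈ m / n ⌉
m≤n*⌈m/n⌉ m n@(suc q) = +-cancelˡ-≤ q m (n * c) (begin
  q + m               ≡⟨ +-comm q m ⟩
  m + q               ≡⟨ m≡m%n+[m/n]*n (m + q) n ⟩
  (m + q) % n + c * n ≤⟨ +-monoˡ-≤ (c * n) (s≤s⁻¹ (m%n<n (m + q) n)) ⟩
  q + c * n           ≡⟨ cong (q +_) (*-comm c n) ⟩
  q + n * c           ∎)
  where
  open ≤-Reasoning
  c : ℕ
  c = ⌈ m / n ⌉

m≤n*o⇒⌈m/n⌉≤o : ∀ m n {o} .{{_ : NonZero n}} → m ≤ n * o → ⌈ m / n ⌉ ≤ o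
m≤n*o⇒⌈m/n⌉≤o m n@(suc q) {o} m≤n*o = s≤s⁻¹ (m<n*o⇒m/o<n (s≤s (begin
  m + q         ≤⟨ +-monoˡ-≤ q m≤n*o ⟩
  n * o + q     ≡⟨ +-comm (n * o) q ⟩
  q + n * o     ≡⟨ cong (q +_) (*-comm n o) ⟩
  q + o * n     ∎)))
  where open ≤-Reasoning

⌈m/n⌉≢0 : ∀ m n .{{_ : NonZero m}} .{{_ : NonZero n}} → NonZero ⌈ m / n ⌉
⌈m/n⌉≢0 m@(suc k) n@(suc q) = >-nonZero (m≥n⇒m/n>0 (s≤s (m≤n+m q k)))

∣p∩q∣+∣p∩∁q∣≡∣p∣ : ∀ {n} (p q : Subset n) → ∣ p ∩ q ∣ + ∣ p ∩ ∁ q ∣ ≡ ∣ p ∣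
∣p∩q∣+∣p∩∁q∣≡∣p∣ []            []            = refl
∣p∩q∣+∣p∩∁q∣≡∣p∣ (outside ∷ p) (_ ∷ q)       = ∣p∩q∣+∣p∩∁q∣≡∣p∣ p q
∣p∩q∣+∣p∩∁q∣≡∣p∣ (inside ∷ p)  (inside ∷ q)  = cong suc (∣p∩q∣+∣p∩∁q∣≡∣p∣ p q)
∣p∩q∣+∣p∩∁q∣≡∣p∣ (inside ∷ p)  (outside ∷ q) = trans (+-suc _ _) (cong suc (∣p∩q∣+∣p∩∁q∣≡∣p∣ p q))

[p∩q]∪[p∩∁q]≡p : ∀ {n} (p q : Subset n) → (p ∩ q) ∪ (p ∩ ∁ q) ≡ p
[p∩q]∪[p∩∁q]≡p []            []            = refl
[p∩q]∪[p∩∁q]≡p (outside ∷ p) (_ ∷ q)       = cong (outside ∷_) ([p∩q]∪[p∩∁q]≡p p q)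
[p∩q]∪[p∩∁q]≡p (inside ∷ p)  (inside ∷ q)  = cong (inside ∷_) ([p∩q]∪[p∩∁q]≡p p q)
[p∩q]∪[p∩∁q]≡p (inside ∷ p)  (outside ∷ q) = cong (inside ∷_) ([p∩q]∪[p∩∁q]≡p p q)

[p∩q]∩[p∩∁q]≡⊥ : ∀ {n} (p q : Subset n) → (p ∩ q) ∩ (p ∩ ∁ q) ≡ ⊥
[p∩q]∩[p∩∁q]≡⊥ []            []            = refl
[p∩q]∩[p∩∁q]≡⊥ (outside ∷ p) (_ ∷ q)       = cong (outside ∷_) ([p∩q]∩[p∩∁q]≡⊥ p q)
[p∩q]∩[p∩∁q]≡⊥ (inside ∷ p)  (inside ∷ q)  = cong (outside ∷_) ([p∩q]∩[p∩∁q]≡⊥ p q)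
[p∩q]∩[p∩∁q]≡⊥ (inside ∷ p)  (outside ∷ q) = cong (outside ∷_) ([p∩q]∩[p∩∁q]≡⊥ p q)

p⊆q⇒p∩r⊆q∩r : ∀ {n} {p q : Subset n} r → p ⊆ q → p ∩ r ⊆ q ∩ r
p⊆q⇒p∩r⊆q∩r {p = p} r p⊆q x∈p∩r with x∈p∩q⁻ p r x∈p∩r
... | x∈p , x∈r = x∈p∩q⁺ (p⊆q x∈p , x∈r)

truncate : ∀ {n} → ℕ → Subset n → Subset n
truncate zero    p             = ⊥
truncate (suc k) []            = []
truncate (suc k) (outside ∷ p) = outside ∷ truncate (suc k) p
truncate (suc k) (inside ∷ p)  = inside ∷ truncate k p

truncate-⊆ : ∀ {n} k (p : Subset n) → truncate k p ⊆ p
truncate-⊆ zero    p             = ⊥⊆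
truncate-⊆ (suc k) []            = λ ()
truncate-⊆ (suc k) (outside ∷ p) = out⊆ (truncate-⊆ (suc k) p)
truncate-⊆ (suc k) (inside ∷ p)  = s⊆s (truncate-⊆ k p)

∣truncate∣≤ : ∀ {n} k (p : Subset n) → ∣ truncate k p ∣ ≤ k
∣truncate∣≤ {n} zero p          = ≤-reflexive (∣⊥∣≡0 n)
∣truncate∣≤ (suc k) []            = z≤n
∣truncate∣≤ (suc k) (outside ∷ p) = ∣truncate∣≤ (suc k) p
∣truncate∣≤ (suc k) (inside ∷ p)  = s≤s (∣truncate∣≤ k p)

∣truncate∣≡ : ∀ {n} k (p : Subset n) → k ≤ ∣ p ∣ → ∣ truncate k p ∣ ≡ k
∣truncate∣≡ {n} zero p          _             = ∣⊥∣≡0 n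
∣truncate∣≡ (suc k) (outside ∷ p) k≤∣p∣         = ∣truncate∣≡ (suc k) p k≤∣p∣
∣truncate∣≡ (suc k) (inside ∷ p)  (s≤s k≤∣p∣) = cong suc (∣truncate∣≡ k p k≤∣p∣)

elements : ∀ {n} → Subset n → List (Fin n)
elements []            = []
elements (outside ∷ p) = map suc (elements p)
elements (inside ∷ p)  = zero ∷ map suc (elements p)

length-elements : ∀ {n} (p : Subset n) → length (elements p) ≡ ∣ p ∣
length-elements []            = refl
length-elements (outside ∷ p) = trans (length-map suc (elements p)) (length-elements p)
length-elements (inside ∷ p)  = cong suc (trans (length-map suc (elements p)) (length-elements p))

∈⇒∈elements : ∀ {n} {x : Fin n} {p} → x ∈ p → x ∈ₗ elements p
∈⇒∈elements {p = inside ∷ p}  here        = here refl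
∈⇒∈elements {p = outside ∷ p} (there x∈p) = ∈-map⁺ suc (∈⇒∈elements x∈p)
∈⇒∈elements {p = inside ∷ p}  (there x∈p) = there (∈-map⁺ suc (∈⇒∈elements x∈p))

disc : ∀ {n} → Subset n → Subset n → ℕ
disc τ X = ∣ ∣ X ∩ τ ∣ - ∣ X ∩ ∁ τ ∣ ∣

disc² : ∀ {n} → Subset n → Subset n → ℕ
disc² τ X = disc τ X * disc τ X

disc²-average : ∀ {n} x (X τ : Subset n) →
  disc² (true ∷ τ) (x ∷ X) + disc² (false ∷ τ) (x ∷ X) + 2 * ∣ X ∣ ≡ 2 * disc² τ X + 2 * ∣ x ∷ X ∣
disc²-average false X τ = double (disc τ X) ∣ X ∣
  where
  double : ∀ d k → d * d + d * d + 2 * k ≡ 2 * (d * d) + 2 * k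
  double = solve-∀
disc²-average true X τ = begin
  _                             ≡⟨ cong (_+ 2 * ∣ X ∣) (∣1+m-n∣²+∣m-1+n∣²≡2∣m-n∣²+2 ∣ X ∩ τ ∣ ∣ X ∩ ∁ τ ∣) ⟩
  2 * disc² τ X + 2 + 2 * ∣ X ∣ ≡⟨ shift (disc² τ X) ∣ X ∣ ⟩
  _                             ∎
  where
  open ≡-Reasoning
  shift : ∀ e k → 2 * e + 2 + 2 * k ≡ 2 * e + 2 * suc k
  shift = solve-∀

Balanced : ∀ {n} → Subset n → Subset n → Set
Balanced τ X = ∣ X ∣ ≤ 3 * ∣ X ∩ τ ∣ × ∣ X ∣ ≤ 3 * ∣ X ∩ ∁ τ ∣

3disc≤∣X∣⇒Balanced : ∀ {n} (τ X : Subset n) → 3 * disc τ X ≤ ∣ X ∣ → Balanced τ X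
3disc≤∣X∣⇒Balanced τ X 3d≤∣X∣ =
  subst (_≤ 3 * x) split (3∣m-n∣≤m+n⇒m+n≤3m x y (subst (3 * disc τ X ≤_) (sym split) 3d≤∣X∣)) ,
  subst (_≤ 3 * y) split′ (3∣m-n∣≤m+n⇒m+n≤3m y x (subst₂ (λ d k → 3 * d ≤ k) (∣-∣-comm x y) (sym split′) 3d≤∣X∣))
  where
  x y : ℕ
  x = ∣ X ∩ τ ∣
  y = ∣ X ∩ ∁ τ ∣
  split : x + y ≡ ∣ X ∣
  split = ∣p∩q∣+∣p∩∁q∣≡∣p∣ X τ
  split′ : y + x ≡ ∣ X ∣
  split′ = trans (+-comm y x) split

Family : ℕ → Set
Family n = List (ℕ × Subset n)

potential : ∀ {n} → Subset n → Family n → ℕ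
potential τ F = sum (map (λ (w , X) → w * disc² τ X) F)

weight : ∀ {n} → Family n → ℕ
weight F = sum (map (λ (w , X) → w * ∣ X ∣) F)

tails : ∀ {n} → Family (suc n) → Family n
tails = map (λ (w , X) → w , tail X)

potential-average : ∀ {n} (F : Family (suc n)) τ →
  potential (true ∷ τ) F + potential (false ∷ τ) F + 2 * weight (tails F)
    ≡ 2 * potential τ (tails F) + 2 * weight F
potential-average []                 τ = refl
potential-average ((w , x ∷ X) ∷ F) τ = begin
  (w * a + pa) + (w * b + pb) + 2 * (w * k + wk) ≡⟨ regroup w a b k pa pb wk ⟩
  w * (a + b + 2 * k) + (pa + pb + 2 * wk)       ≡⟨ cong₂ (λ u v → w * u + v) (disc²-average x X τ) (potential-average F τ) ⟩
  w * (2 * c + 2 * k′) + (2 * pc + 2 * wk′)      ≡⟨ ungroup w c k′ pc wk′ ⟩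
  2 * (w * c + pc) + 2 * (w * k′ + wk′)          ∎
  where
  open ≡-Reasoning
  a b c k k′ pa pb pc wk wk′ : ℕ
  a   = disc² (true ∷ τ) (x ∷ X)
  b   = disc² (false ∷ τ) (x ∷ X)
  c   = disc² τ X
  k   = ∣ X ∣
  k′  = ∣ x ∷ X ∣
  pa  = potential (true ∷ τ) F
  pb  = potential (false ∷ τ) F
  pc  = potential τ (tails F)
  wk  = weight (tails F)
  wk′ = weight F
  regroup : ∀ w a b k pa pb wk →
    (w * a + pa) + (w * b + pb) + 2 * (w * k + wk) ≡ w * (a + b + 2 * k) + (pa + pb + 2 * wk)
  regroup = solve-∀
  ungroup : ∀ w c k′ pc wk′ →
    w * (2 * c + 2 * k′) + (2 * pc + 2 * wk′) ≡ 2 * (w * c + pc) + 2 * (w * k′ + wk′)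
  ungroup = solve-∀

potential-sum≤ : ∀ {n} (F : Family (suc n)) τ → potential τ (tails F) ≤ weight (tails F) →
  potential (true ∷ τ) F + potential (false ∷ τ) F ≤ 2 * weight F
potential-sum≤ F τ tails≤ = +-cancelʳ-≤ (2 * weight (tails F)) (pt + pf) (2 * weight F) (begin
  pt + pf + 2 * weight (tails F)           ≡⟨ potential-average F τ ⟩
  2 * potential τ (tails F) + 2 * weight F ≤⟨ +-monoˡ-≤ (2 * weight F) (*-monoʳ-≤ 2 tails≤) ⟩
  2 * weight (tails F) + 2 * weight F      ≡⟨ +-comm (2 * weight (tails F)) (2 * weight F) ⟩
  2 * weight F + 2 * weight (tails F)      ∎)
  where
  open ≤-Reasoning
  pt pf : ℕ
  pt = potential (true ∷ τ) F
  pf = potential (false ∷ τ) F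

extend-colouring : ∀ {n} (F : Family (suc n)) τ → potential τ (tails F) ≤ weight (tails F) →
  ∃[ τ′ ] potential τ′ F ≤ weight F
extend-colouring F τ tails≤ with ≤-total (potential (true ∷ τ) F) (potential (false ∷ τ) F)
... | inj₁ t≤f = true ∷ τ , m≤n⇒m+n≤2o⇒m≤o t≤f (potential-sum≤ F τ tails≤)
... | inj₂ f≤t = false ∷ τ , m≤n⇒m+n≤2o⇒m≤o f≤t
                   (subst (_≤ 2 * weight F) (+-comm (potential (true ∷ τ) F) _) (potential-sum≤ F τ tails≤))

potential-[] : (F : Family 0) → potential [] F ≡ 0
potential-[] []             = refl
potential-[] ((w , []) ∷ F) = cong₂ _+_ (*-zeroʳ w) (potential-[] F)

∃-potential≤weight : ∀ {n} (F : Family n) → ∃[ τ ] potential τ F ≤ weight F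
∃-potential≤weight {zero}  F = [] , subst (_≤ weight F) (sym (potential-[] F)) z≤n
∃-potential≤weight {suc n} F with ∃-potential≤weight (tails F)
... | τ , tails≤ = extend-colouring F τ tails≤

∈⇒≤potential : ∀ {n w X} {F : Family n} τ → (w , X) ∈ₗ F → w * disc² τ X ≤ potential τ F
∈⇒≤potential τ (here refl)                 = m≤m+n _ _
∈⇒≤potential τ (there {x = w′ , X′} w,X∈F) = ≤-trans (∈⇒≤potential τ w,X∈F) (m≤n+m _ (w′ * disc² τ X′))

∈⇒Balanced : ∀ {n w W} {F : Family n} τ X .{{_ : NonZero w}} → (w , X) ∈ₗ F →
  potential τ F ≤ W → 9 * W ≤ w * (∣ X ∣ * ∣ X ∣) → Balanced τ X
∈⇒Balanced {w = w} {W} τ X w,X∈F potential≤W 9W≤w*∣X∣² = 3disc≤∣X∣⇒Balanced τ X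
  (w*d²≤W⇒9W≤w*k²⇒3d≤k w (disc τ X) ∣ X ∣ W (≤-trans (∈⇒≤potential τ w,X∈F) potential≤W) 9W≤w*∣X∣²)

weight-map≤ : ∀ {n} {I : Set} w k (X : I → Subset n) (L : List I) → (∀ v → ∣ X v ∣ ≤ k) →
  weight (map (λ v → w , X v) L) ≤ w * k * length L
weight-map≤ w k X []      ∣X∣≤k = z≤n
weight-map≤ w k X (v ∷ L) ∣X∣≤k = begin
  w * ∣ X v ∣ + weight (map (λ v → w , X v) L) ≤⟨ +-mono-≤ (*-monoʳ-≤ w (∣X∣≤k v)) (weight-map≤ w k X L ∣X∣≤k) ⟩
  w * k + w * k * length L                     ≡⟨ *-suc (w * k) (length L) ⟨
  w * k * suc (length L)                       ∎
  where open ≤-Reasoning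

module BalancedSplit {n} (p q : ℕ) (G : Graph n) (A B : Subset n)
  (100≤∣A∣ : 100 ≤ ∣ A ∣)
  (B-small : 100 * suc q * ∣ B ∣ ≤ suc p * ∣ A ∣)
  (deg-large : ∀ b → b ∈ B → suc p * ∣ A ∣ ≤ suc q * degIn G b A) where

  a : ℕ
  a = ∣ A ∣

  s : ℕ
  s = ⌈ suc p * a / suc q ⌉

  instance
    a≢0 : NonZero a
    a≢0 = >-nonZero (≤-trans (s≤s z≤n) 100≤∣A∣)

    s≢0 : NonZero s
    s≢0 = ⌈m/n⌉≢0 (suc p * a) (suc q) {{m*n≢0 (suc p) a}}

  αa≤s : suc p * a ≤ suc q * s
  αa≤s = m≤n*⌈m/n⌉ (suc p * a) (suc q)

  s≤deg : ∀ b → b ∈ B → s ≤ degIn G b A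
  s≤deg b b∈B = m≤n*o⇒⌈m/n⌉≤o (suc p * a) (suc q) (deg-large b b∈B)

  100∣B∣≤s : 100 * ∣ B ∣ ≤ s
  100∣B∣≤s = *-cancelˡ-≤ (suc q) (≤-trans (≤-reflexive (swap (suc q) ∣ B ∣)) (≤-trans B-small αa≤s))
    where
    swap : ∀ Q m → Q * (100 * m) ≡ 100 * Q * m
    swap = solve-∀

  S : Fin n → Subset n
  S v = truncate s (nbhd G v ∩ A)

  family : Family n
  family = (s * s , A) ∷ map (λ v → 100 * a , S v) (elements B)

  weight≤2s²a : weight family ≤ 2 * (s * s * a)
  weight≤2s²a = begin
    s * s * a + weight (map (λ v → 100 * a , S v) (elements B))
      ≤⟨ +-monoʳ-≤ (s * s * a) (weight-map≤ (100 * a) s S (elements B) (λ v → ∣truncate∣≤ s (nbhd G v ∩ A))) ⟩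
    s * s * a + 100 * a * s * length (elements B)
      ≡⟨ cong (λ m → s * s * a + 100 * a * s * m) (length-elements B) ⟩
    s * s * a + 100 * a * s * ∣ B ∣
      ≡⟨ regroup s a ∣ B ∣ ⟩
    s * s * a + a * s * (100 * ∣ B ∣)
      ≤⟨ +-monoʳ-≤ (s * s * a) (*-monoʳ-≤ (a * s) 100∣B∣≤s) ⟩
    s * s * a + a * s * s
      ≡⟨ double s a ⟩
    2 * (s * s * a) ∎
    where
    open ≤-Reasoning
    regroup : ∀ s a m → s * s * a + 100 * a * s * m ≡ s * s * a + a * s * (100 * m)
    regroup = solve-∀
    double : ∀ s a → s * s * a + a * s * s ≡ 2 * (s * s * a)
    double = solve-∀

  τ : Subset n
  τ = proj₁ (∃-potential≤weight family)

  potential≤2s²a : potential τ family ≤ 2 * (s * s * a)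
  potential≤2s²a = ≤-trans (proj₂ (∃-potential≤weight family)) weight≤2s²a

  T T′ : Subset n
  T  = A ∩ τ
  T′ = A ∩ ∁ τ

  9*2s²a≤s²*a² : 9 * (2 * (s * s * a)) ≤ s * s * (a * a)
  9*2s²a≤s²*a² = begin
    9 * (2 * (s * s * a)) ≡⟨ eighteen s a ⟩
    s * s * (18 * a)      ≤⟨ *-monoʳ-≤ (s * s) (*-monoˡ-≤ a (≤-trans (m≤m+n 18 82) 100≤∣A∣)) ⟩
    s * s * (a * a)       ∎
    where
    open ≤-Reasoning
    eighteen : ∀ s a → 9 * (2 * (s * s * a)) ≡ s * s * (18 * a)
    eighteen = solve-∀

  9*2s²a≤100a*s² : 9 * (2 * (s * s * a)) ≤ 100 * a * (s * s)
  9*2s²a≤100a*s² = begin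
    9 * (2 * (s * s * a)) ≡⟨ eighteen s a ⟩
    18 * (a * (s * s))    ≤⟨ *-monoˡ-≤ (a * (s * s)) (m≤m+n 18 82) ⟩
    100 * (a * (s * s))   ≡⟨ *-assoc 100 a (s * s) ⟨
    100 * a * (s * s)     ∎
    where
    open ≤-Reasoning
    eighteen : ∀ s a → 9 * (2 * (s * s * a)) ≡ 18 * (a * (s * s))
    eighteen = solve-∀

  A-balanced : Balanced τ A
  A-balanced = ∈⇒Balanced {F = family} τ A {{m*n≢0 s s}} (here refl) potential≤2s²a 9*2s²a≤s²*a²

  3∣T∣≤2a : 3 * ∣ T ∣ ≤ 2 * a
  3∣T∣≤2a = subst (λ k → 3 * ∣ T ∣ ≤ 2 * k) split
    (m+n≤3n⇒3m≤2[m+n] ∣ T ∣ ∣ T′ ∣ (subst (_≤ 3 * ∣ T′ ∣) (sym split) (proj₂ A-balanced)))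
    where
    split : ∣ T ∣ + ∣ T′ ∣ ≡ a
    split = ∣p∩q∣+∣p∩∁q∣≡∣p∣ A τ

  S-balanced : ∀ b → b ∈ B → s ≤ 3 * ∣ S b ∩ τ ∣
  S-balanced b b∈B = subst (_≤ 3 * ∣ S b ∩ τ ∣) ∣S∣≡s (proj₁
    (∈⇒Balanced {F = family} τ (S b) {{m*n≢0 100 a}} (there (∈-map⁺ _ (∈⇒∈elements b∈B))) potential≤2s²a
      (subst (λ k → 9 * (2 * (s * s * a)) ≤ 100 * a * (k * k)) (sym ∣S∣≡s) 9*2s²a≤100a*s²)))
    where
    ∣S∣≡s : ∣ S b ∣ ≡ s
    ∣S∣≡s = ∣truncate∣≡ s (nbhd G b ∩ A) (s≤deg b b∈B)

  ∣S∩τ∣≤degT : ∀ b → ∣ S b ∩ τ ∣ ≤ degIn G b T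
  ∣S∩τ∣≤degT b = subst (∣ S b ∩ τ ∣ ≤_) (cong ∣_∣ (∩-assoc (nbhd G b) A τ))
    (p⊆q⇒∣p∣≤∣q∣ (p⊆q⇒p∩r⊆q∩r τ (truncate-⊆ s (nbhd G b ∩ A))))

  deg-T-large : ∀ b → b ∈ B → suc p * ∣ T ∣ ≤ 2 * suc q * degIn G b T
  deg-T-large b b∈B = *-cancelˡ-≤ 3 (begin
    3 * (suc p * ∣ T ∣)           ≡⟨ swap 3 (suc p) ∣ T ∣ ⟩
    suc p * (3 * ∣ T ∣)           ≤⟨ *-monoʳ-≤ (suc p) 3∣T∣≤2a ⟩
    suc p * (2 * a)               ≡⟨ swap (suc p) 2 a ⟩
    2 * (suc p * a)               ≤⟨ *-monoʳ-≤ 2 αa≤s ⟩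
    2 * (suc q * s)               ≤⟨ *-monoʳ-≤ 2 (*-monoʳ-≤ (suc q) (S-balanced b b∈B)) ⟩
    2 * (suc q * (3 * x))         ≡⟨ regroup (suc q) x ⟩
    3 * (2 * suc q * x)           ≤⟨ *-monoʳ-≤ 3 (*-monoʳ-≤ (2 * suc q) (∣S∩τ∣≤degT b)) ⟩
    3 * (2 * suc q * degIn G b T) ∎)
    where
    open ≤-Reasoning
    x : ℕ
    x = ∣ S b ∩ τ ∣
    swap : ∀ k m n → k * (m * n) ≡ m * (k * n)
    swap = solve-∀
    regroup : ∀ Q x → 2 * (Q * (3 * x)) ≡ 3 * (2 * Q * x)
    regroup = solve-∀

lemma15 : ∀ {n} (p q : ℕ) (G : Graph n) (A B : Subset n)
          → A ∩ B ≡ ⊥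
          → 100 ≤ ∣ A ∣
          → 100 * suc q * ∣ B ∣ ≤ suc p * ∣ A ∣
          → (∀ b → b ∈ B → suc p * ∣ A ∣ ≤ suc q * degIn G b A)
          → Σ (Subset n) λ T → Σ (Subset n) λ T′ →
              (T ∪ T′ ≡ A) × (T ∩ T′ ≡ ⊥)
              × (∣ A ∣ ≤ 3 * ∣ T ∣) × (∣ A ∣ ≤ 3 * ∣ T′ ∣)
              × (∀ b → b ∈ B → suc p * ∣ T ∣ ≤ 2 * suc q * degIn G b T)
lemma15 p q G A B _ 100≤∣A∣ B-small deg-large =
  T , T′ , [p∩q]∪[p∩∁q]≡p A τ , [p∩q]∩[p∩∁q]≡⊥ A τ , proj₁ A-balanced , proj₂ A-balanced , deg-T-large
  where open BalancedSplit p q G A B 100≤∣A∣ B-small deg-large
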